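{- Let $\mathcal{GJL}_{CS}$ be any one of $\mathcal{GJ}_{CS},\mathcal{GJT}_{CS},\mathcal{GJ}4_{CS},\mathcal{GLP}_{CS}$ (with $CS$ a constant specification for that calculus), and let $\Gamma\cup\{\phi\}\subseteq\mathcal{L}_0$. If $\Gamma\vdash_{\mathcal{GJL}_{CS}}\phi$, then $\Gamma\vdash_{\mathcal{G}}\phi$.
   Context: Justification terms $Jt$: $t::=x\mid c\mid[t\cdot t]\mid[t+t]\mid\,!t\mid\,?t$ ($x$ term variables, $c$ constants, countably many each). Formulas $\mathcal{L}_J$: $\phi::=\bot\mid p\mid(\phi\land\phi)\mid(\phi\rightarrow\phi)\mid t:\phi$, $p\in Var=\{p_i\mid i\in\mathbb{N}\}$. $\mathcal{L}_0\subseteq\mathcal{L}_J$ is the purely propositional fragment (no $t:$). $\neg\phi:=\phi\to\bot$. $\mathcal{G}$ (Hilbert calculus of propositional Gödel logic) has axiom schemes (A1) $(\phi\to\psi)\to((\psi\to\chi)\to(\phi\to\chi))$, (A2) $(\phi\land\psi)\to\phi$, (A3) $(\phi\land\psi)\to(\psi\land\phi)$, (A5a) $(\phi\to(\psi\to\chi))\to((\phi\land\psi)\to\chi)$, (A5b) $((\phi\land\psi)\to\chi)\to(\phi\to(\psi\to\chi))$, (A6) $((\phi\to\psi)\to\chi)\to(((\psi\to\phi)\to\chi)\to\chi)$, (A7) $\bot\to\phi$, (G4) $\phi\to(\phi\land\phi)$, with modus ponens. $\mathcal{GJ}_0$: all $\mathcal{L}_J$-instances of these schemes, plus (J) $t:(\phi\to\psi)\to(s:\phi\to[t\cdot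 s]:\psi)$, (+) $t:\phi\to[t+s]:\phi$, $s:\phi\to[t+s]:\phi$, and modus ponens. (F) $t:\phi\to\phi$; (PI) $t:\phi\to\,!t:t:\phi$. A constant specification for a calculus $\mathcal{S}$ is a downward closed set $CS$ of formulas $c_n:\dots:c_1:\phi$ ($n\ge1$, $c_i$ constants, $\phi$ an axiom of $\mathcal{S}$; downward closed means $c_i:\dots:c_1:\phi\in CS$ for $i<n$ whenever $c_n:\dots:c_1:\phi\in CS$). $\mathcal{GJ}_{CS}$ is $\mathcal{GJ}_0$ plus the rule "infer $c:\psi$ for each $c:\psi\in CS$"; $\mathcal{GJT}_{CS}=\mathcal{GJ}_{CS}+(F)$, $\mathcal{GJ}4_{CS}=\mathcal{GJ}_{CS}+(PI)$, $\mathcal{GLP}_{CS}=\mathcal{GJT}_{CS}+(PI)$. $\Gamma\vdash\phi$ denotes derivability from premises $\Gamma$. -}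

module Defs where

open import Data.Nat using (ℕ; suc)
open import Data.Product using (Σ; _×_; _,_)

data Term : Set where
  var   : ℕ → Term
  const : ℕ → Term
  _·_   : Term → Term → Term
  _⊕_   : Term → Term → Term
  !_    : Term → Term
  ¿_    : Term → Term

infixr 5 _⇒_
infixr 6 _∧_
infixr 7 _∶_
data Fm : Set where
  ⊥'   : Fm
  pv   : ℕ → Fm
  _∧_  : Fm → Fm → Fm
  _⇒_  : Fm → Fm → Fm
  _∶_  : Term → Fm → Fm

data IsL0 : Fm → Set where
  ⊥L0 : IsL0 ⊥'
  pL0 : ∀ i → IsL0 (pv i)
  ∧L0 : ∀ {a b} → IsL0 a → IsL0 b → IsL0 (a ∧ b)
  ⇒L0 : ∀ {a b} → IsL0 a → IsL0 b → IsL0 (a ⇒ b)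

data GAx : Fm → Set where
  A1  : ∀ φ ψ χ → GAx ((φ ⇒ ψ) ⇒ ((ψ ⇒ χ) ⇒ (φ ⇒ χ)))
  A2  : ∀ φ ψ → GAx ((φ ∧ ψ) ⇒ φ)
  A3  : ∀ φ ψ → GAx ((φ ∧ ψ) ⇒ (ψ ∧ φ))
  A5a : ∀ φ ψ χ → GAx ((φ ⇒ (ψ ⇒ χ)) ⇒ ((φ ∧ ψ) ⇒ χ))
  A5b : ∀ φ ψ χ → GAx (((φ ∧ ψ) ⇒ χ) ⇒ (φ ⇒ (ψ ⇒ χ)))
  A6  : ∀ φ ψ χ → GAx (((φ ⇒ ψ) ⇒ χ) ⇒ (((ψ ⇒ φ) ⇒ χ) ⇒ χ))
  A7  : ∀ φ → GAx (⊥' ⇒ φ)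
  G4  : ∀ φ → GAx (φ ⇒ (φ ∧ φ))

data Logic : Set where
  GJ GJT GJ4 GLP : Logic

data HasF : Logic → Set where
  fT  : HasF GJT
  fLP : HasF GLP

data HasPI : Logic → Set where
  pi4  : HasPI GJ4
  piLP : HasPI GLP

data Ax (L : Logic) : Fm → Set where
  gax  : ∀ {φ} → GAx φ → Ax L φ
  jax  : ∀ t s φ ψ → Ax L ((t ∶ (φ ⇒ ψ)) ⇒ ((s ∶ φ) ⇒ ((t · s) ∶ ψ)))
  +l   : ∀ t s φ → Ax L ((t ∶ φ) ⇒ ((t ⊕ s) ∶ φ))
  +r   : ∀ t s φ → Ax L ((s ∶ φ) ⇒ ((t ⊕ s) ∶ φ))
  fax  : HasF L → ∀ t φ → Ax L ((t ∶ φ) ⇒ φ)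
  piax : HasPI L → ∀ t φ → Ax L ((t ∶ φ) ⇒ ((! t) ∶ (t ∶ φ)))

Set-of-Fm : Set₁
Set-of-Fm = Fm → Set

data ConstChain (L : Logic) : Fm → Set where
  base : ∀ c {φ} → Ax L φ → ConstChain L (const c ∶ φ)
  step : ∀ c {ψ} → ConstChain L ψ → ConstChain L (const c ∶ ψ)

record IsCS (L : Logic) (CS : Set-of-Fm) : Set where
  field
    chain    : ∀ {φ} → CS φ → ConstChain L φ
    downward : ∀ c ψ → CS (const c ∶ ψ) → ConstChain L ψ → CS ψ

data _⊢[_,_]_ (Γ : Set-of-Fm) (L : Logic) (CS : Set-of-Fm) : Fm → Set where
  prem : ∀ {φ} → Γ φ → Γ ⊢[ L , CS ] φ
  ax   : ∀ {φ} → Ax L φ → Γ ⊢[ L , CS ] φ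
  csr  : ∀ {φ} → CS φ → Γ ⊢[ L , CS ] φ
  mp   : ∀ {φ ψ} → Γ ⊢[ L , CS ] (φ ⇒ ψ) → Γ ⊢[ L , CS ] φ → Γ ⊢[ L , CS ] ψ

data _⊢G_ (Γ : Set-of-Fm) : Fm → Set where
  prem : ∀ {φ} → Γ φ → Γ ⊢G φ
  ax   : ∀ {φ} → IsL0 φ → GAx φ → Γ ⊢G φ
  mp   : ∀ {φ ψ} → Γ ⊢G (φ ⇒ ψ) → Γ ⊢G φ → Γ ⊢G ψ

module Submission where

-- Erasing every justification prefix t ∶ maps each axiom of GJL either to an
-- instance of a G-scheme (the G-axioms) or to a G-theorem of the form X ⇒ X
-- (axioms J, +, F, PI), and every member of a constant specification to the
-- erasure of such an axiom; modus ponens commutes with erasure.  Since erasure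
-- fixes L₀, a GJL_CS-derivation between L₀-formulas erases to a G-derivation.

open import Defs
open import Relation.Binary.PropositionalEquality using (_≡_; refl; sym; subst; cong₂)

forget : Fm → Fm
forget ⊥'      = ⊥'
forget (pv i)  = pv i
forget (a ∧ b) = forget a ∧ forget b
forget (a ⇒ b) = forget a ⇒ forget b
forget (t ∶ a) = forget a

forget-L0 : ∀ φ → IsL0 (forget φ)
forget-L0 ⊥'      = ⊥L0
forget-L0 (pv i)  = pL0 i
forget-L0 (a ∧ b) = ∧L0 (forget-L0 a) (forget-L0 b)
forget-L0 (a ⇒ b) = ⇒L0 (forget-L0 a) (forget-L0 b)
forget-L0 (t ∶ a) = forget-L0 a

forget-id : ∀ {φ} → IsL0 φ → forget φ ≡ φ
forget-id ⊥L0       = refl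
forget-id (pL0 i)   = refl
forget-id (∧L0 a b) = cong₂ _∧_ (forget-id a) (forget-id b)
forget-id (⇒L0 a b) = cong₂ _⇒_ (forget-id a) (forget-id b)

forget-GAx : ∀ {φ} → GAx φ → GAx (forget φ)
forget-GAx (A1 φ ψ χ)  = A1 _ _ _
forget-GAx (A2 φ ψ)    = A2 _ _
forget-GAx (A3 φ ψ)    = A3 _ _
forget-GAx (A5a φ ψ χ) = A5a _ _ _
forget-GAx (A5b φ ψ χ) = A5b _ _ _
forget-GAx (A6 φ ψ χ)  = A6 _ _ _
forget-GAx (A7 φ)      = A7 _
forget-GAx (G4 φ)      = G4 _

-- A1 chains G4 : X ⇒ X ∧ X with A2 : X ∧ X ⇒ X.
⊢G-⇒-refl : ∀ {Γ X} → IsL0 X → Γ ⊢G (X ⇒ X)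
⊢G-⇒-refl {X = X} x = mp (mp (ax (⇒L0 dup (⇒L0 proj (⇒L0 x x))) (A1 X (X ∧ X) X))
                            (ax dup (G4 X)))
                        (ax proj (A2 X X))
  where
  dup : IsL0 (X ⇒ X ∧ X)
  dup = ⇒L0 x (∧L0 x x)
  proj : IsL0 (X ∧ X ⇒ X)
  proj = ⇒L0 (∧L0 x x) x

forget-Ax : ∀ {Γ L φ} → Ax L φ → Γ ⊢G forget φ
forget-Ax {φ = φ} (gax g)  = ax (forget-L0 φ) (forget-GAx g)
forget-Ax (jax t s φ ψ)    = ⊢G-⇒-refl (⇒L0 (forget-L0 φ) (forget-L0 ψ))
forget-Ax (+l t s φ)       = ⊢G-⇒-refl (forget-L0 φ)
forget-Ax (+r t s φ)       = ⊢G-⇒-refl (forget-L0 φ)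
forget-Ax (fax _ t φ)      = ⊢G-⇒-refl (forget-L0 φ)
forget-Ax (piax _ t φ)     = ⊢G-⇒-refl (forget-L0 φ)

forget-ConstChain : ∀ {Γ L φ} → ConstChain L φ → Γ ⊢G forget φ
forget-ConstChain (base c a)  = forget-Ax a
forget-ConstChain (step c ch) = forget-ConstChain ch

forget-⊢ : ∀ {Γ Δ L CS} →
           (∀ {ψ} → CS ψ → ConstChain L ψ) →
           (∀ {ψ} → Γ ψ → Δ ⊢G forget ψ) →
           ∀ {φ} → Γ ⊢[ L , CS ] φ → Δ ⊢G forget φ
forget-⊢ chain premise (prem g) = premise g
forget-⊢ chain premise (ax a)   = forget-Ax a
forget-⊢ chain premise (csr c)  = forget-ConstChain (chain c)
forget-⊢ chain premise (mp d e) = mp (forget-⊢ chain premise d) (forget-⊢ chain premise e)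

mainTheorem3 : (L : Logic) (CS : Set-of-Fm) → IsCS L CS →
               (Γ : Set-of-Fm) (φ : Fm) →
               (∀ {ψ} → Γ ψ → IsL0 ψ) → IsL0 φ →
               Γ ⊢[ L , CS ] φ → Γ ⊢G φ
mainTheorem3 _ _ isCS Γ _ Γ⊆L0 φ∈L0 d =
  subst (Γ ⊢G_) (forget-id φ∈L0) (forget-⊢ (IsCS.chain isCS) premise d)
  where
  premise : ∀ {ψ} → Γ ψ → Γ ⊢G forget ψ
  premise g = prem (subst Γ (sym (forget-id (Γ⊆L0 g))) g)
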